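{- For all odd $m,n \geq 3$, $\mathsf{DL}(L_{m,n}) = r(L_{m,n}) = (n+m)/2 - 1$.
   Context: $L_{m,n}$ is the $m\times n$ grid graph, i.e. the Cartesian product of a path on $m$ vertices and a path on $n$ vertices. For a finite connected graph $G=(V,E)$ with $|V|=N$ and graph distance $d$, a $k$-dispersed labelling is a bijection $\phi:\{1,\dots,N\}\to V$ with $d(\phi(i),\phi(i+1))\ge k$ for $1\le i\le N-1$; $\mathsf{DL}(G)$ is the maximum such $k$. $r(G)=\min_v\max_u d(v,u)$ is the radius. -}

module Defs where

open import Level using (0ℓ)
open import Data.Nat using (ℕ; zero; suc; _+_; _*_; _≤_)
open import Data.Fin using (Fin; toℕ)
open import Data.Product using (Σ; _×_; _,_; ∃)
open import Data.Sum using (_⊎_)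
open import Function.Bundles using (_⤖_; Bijection)
open import Relation.Binary.PropositionalEquality using (_≡_)

-- A graph: vertex type and adjacency relation (finiteness is carried
-- by the bijection with Fin N in the labelling definitions).
record Graph : Set₁ where
  field
    V   : Set
    Adj : V → V → Set

open Graph public

data Walk (G : Graph) : V G → V G → ℕ → Set where
  here : ∀ {u} → Walk G u u 0
  step : ∀ {u v w k} → Adj G u v → Walk G v w k → Walk G u w (suc k)

Dist : (G : Graph) → V G → V G → ℕ → Set
Dist G u v d = Walk G u v d × (∀ k → Walk G u v k → d ≤ k)

PathAdj : ∀ m → Fin m → Fin m → Set
PathAdj m i j = suc (toℕ i) ≡ toℕ j ⊎ suc (toℕ j) ≡ toℕ i

_□_ : Graph → Graph → Graph
G □ H = record
  { V   = V G × V H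
  ; Adj = λ { (a , b) (a' , b') → (Adj G a a' × b ≡ b') ⊎ (a ≡ a' × Adj H b b') } }

PathGraph : ℕ → Graph
PathGraph m = record { V = Fin m ; Adj = PathAdj m }

L : ℕ → ℕ → Graph
L m n = PathGraph m □ PathGraph n

-- k-dispersed labelling of G with N vertices: a bijection φ : {1..N} → V
-- (labels represented by Fin N, i.e. shifted to 0..N-1) with
-- d(φ(i), φ(i+1)) ≥ k.
IsDispersed : (G : Graph) (N : ℕ) → (Fin N ⤖ V G) → ℕ → Set
IsDispersed G N φ k =
  ∀ (i j : Fin N) → toℕ j ≡ suc (toℕ i) →
    Σ ℕ λ d → Dist G (Bijection.to φ i) (Bijection.to φ j) d × k ≤ d

DispersedLabelling : (G : Graph) (N : ℕ) → ℕ → Set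
DispersedLabelling G N k = Σ (Fin N ⤖ V G) λ φ → IsDispersed G N φ k

DLIs : (G : Graph) (N : ℕ) → ℕ → Set
DLIs G N k = DispersedLabelling G N k × (∀ k' → DispersedLabelling G N k' → k' ≤ k)

EccIs : (G : Graph) → V G → ℕ → Set
EccIs G v e = (Σ (V G) λ u → Dist G v u e) × (∀ u d → Dist G v u d → d ≤ e)

RadiusIs : Graph → ℕ → Set
RadiusIs G r = (Σ (V G) λ v → EccIs G v r) × (∀ v e → EccIs G v e → r ≤ e)

Odd : ℕ → Set
Odd m = Σ ℕ λ k → m ≡ suc (2 * k)

-- With m = 2a + 1 and n = 2b + 1, graph distance in the grid is the Manhattan distance. The
-- centre (a, b) has eccentricity a + b and every vertex is at distance at least a + b from
-- some corner, so r = a + b; the centre's label has a neighbouring label, at distance at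
-- most a + b, so DL ≤ a + b.
-- For DL ≥ a + b let ρ be rotation by a on ℤ/(2a+1): it moves every point by a or a + 1, and
-- the orbit σ(r) = ρʳ(a) runs through 0, …, 2a ending in 0. Label q·n + r goes to (x, y) with
-- y = σ_b(r) and x = σ_a(q), rotated once more by ρ_a when y > b. Within a block y moves by at
-- least b and, being nonzero, crosses the middle row, so x moves by at least a; from one block
-- to the next y goes from 0 to b while x advances by ρ_a.
module Submission where

open import Defs
open import Data.Nat
  using (ℕ; zero; suc; _+_; _*_; _∸_; _≤_; _<_; z≤n; s≤s; z<s; ∣_-_∣; _≤?_; _<?_; ⌊_/2⌋)
open import Data.Nat.Properties
open import Data.Fin using (Fin; zero; suc; toℕ; fromℕ<; fromℕ; inject₁; remQuot; combine)
open import Data.Fin.Properties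
  using ( toℕ-injective; toℕ-fromℕ<; toℕ-fromℕ; toℕ<n; toℕ≤pred[n]; toℕ-inject₁
        ; toℕ-combine; combine-remQuot; *↔×)
open import Data.Fin.Permutation using (Permutation′; permutation; _⟨$⟩ʳ_) renaming (id to idₚ)
open import Data.Product using (Σ; _×_; _,_; proj₁; proj₂)
open import Data.Product.Function.NonDependent.Propositional using (_×-↔_)
open import Data.Sum using (_⊎_; inj₁; inj₂)
open import Function.Base using (_∘′_)
open import Function.Bundles using (_↔_; _⤖_; Bijection; Inverse; mk↔ₛ′)
open import Function.Construct.Composition using (_↔-∘_)
open import Function.Properties.Inverse using (↔⇒⤖)
open import Relation.Binary.Definitions using (Symmetric)
open import Relation.Binary.PropositionalEquality
open import Relation.Nullary using (yes; no; contradiction)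
open import Algebra.Properties.CommutativeSemigroup +-commutativeSemigroup using (interchange)

module _ {G : Graph} where

  _++ʷ_ : ∀ {u v w j k} → Walk G u v j → Walk G v w k → Walk G u w (j + k)
  here     ++ʷ q = q
  step e p ++ʷ q = step e (p ++ʷ q)

  _∷ʳʷ_ : ∀ {u v w k} → Walk G u v k → Adj G v w → Walk G u w (suc k)
  here     ∷ʳʷ e = step e here
  step e p ∷ʳʷ f = step e (p ∷ʳʷ f)

  reverseʷ : Symmetric (Adj G) → ∀ {u v k} → Walk G u v k → Walk G v u k
  reverseʷ adj-sym here       = here
  reverseʷ adj-sym (step e p) = reverseʷ adj-sym p ∷ʳʷ adj-sym e

  Dist-sym : Symmetric (Adj G) → ∀ {u v d} → Dist G u v d → Dist G v u d
  Dist-sym adj-sym (p , minimal) = reverseʷ adj-sym p , λ k q → minimal k (reverseʷ adj-sym q)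

  -- The vertex v carries some label, and a neighbouring label sits at distance at most e from it.
  dispersion≤eccentricity : Symmetric (Adj G) → ∀ {N k e} → 1 < N → (v : V G) →
                            (∀ u d → Dist G v u d → d ≤ e) →
                            DispersedLabelling G N k → k ≤ e
  dispersion≤eccentricity adj-sym {N} {k} {e} 1<N v ecc (ψ , dispersed) =
    neighbour-bound (proj₁ (surjective v)) (proj₂ (surjective v) refl)
    where
    open Bijection ψ using (to; surjective)
    neighbour-bound : ∀ x → to x ≡ v → k ≤ e
    neighbour-bound zero ψx≡v with dispersed zero (fromℕ< 1<N) (toℕ-fromℕ< 1<N)
    ... | d , D , k≤d = ≤-trans k≤d (ecc (to (fromℕ< 1<N)) d (subst (λ w → Dist G w _ d) ψx≡v D))
    neighbour-bound (suc x) ψx≡v with dispersed (inject₁ x) (suc x) (cong suc (sym (toℕ-inject₁ x)))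
    ... | d , D , k≤d =
      ≤-trans k≤d (ecc (to (inject₁ x)) d (subst (λ w → Dist G w _ d) ψx≡v (Dist-sym adj-sym D)))

PathAdj-sym : ∀ {m} → Symmetric (PathAdj m)
PathAdj-sym (inj₁ e) = inj₂ e
PathAdj-sym (inj₂ e) = inj₁ e

□-sym : ∀ {G H} → Symmetric (Adj G) → Symmetric (Adj H) → Symmetric (Adj (G □ H))
□-sym symG symH (inj₁ (e , refl)) = inj₁ (symG e , refl)
□-sym symG symH (inj₂ (refl , e)) = inj₂ (refl , symH e)

L-sym : ∀ {m n} → Symmetric (Adj (L m n))
L-sym = □-sym PathAdj-sym PathAdj-sym

module _ {G H : Graph} where

  mapʷˡ : ∀ {a a' k} (b : V H) → Walk G a a' k → Walk (G □ H) (a , b) (a' , b) k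
  mapʷˡ b here       = here
  mapʷˡ b (step e p) = step (inj₁ (e , refl)) (mapʷˡ b p)

  mapʷʳ : ∀ {b b' k} (a : V G) → Walk H b b' k → Walk (G □ H) (a , b) (a , b') k
  mapʷʳ a here       = here
  mapʷʳ a (step e p) = step (inj₂ (refl , e)) (mapʷʳ a p)

module _ {m : ℕ} where

  path-walk-up : ∀ d (i j : Fin m) → toℕ i + d ≡ toℕ j → Walk (PathGraph m) i j d
  path-walk-up zero    i j i+0≡j =
    subst (λ j → Walk _ i j 0) (toℕ-injective (trans (sym (+-identityʳ _)) i+0≡j)) here
  path-walk-up (suc d) i j i+d+1≡j = step (inj₁ (sym (toℕ-fromℕ< i+1<m)))
    (path-walk-up d _ j (trans (cong (_+ d) (toℕ-fromℕ< i+1<m)) i+1+d≡j))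
    where
    i+1+d≡j : suc (toℕ i) + d ≡ toℕ j
    i+1+d≡j = trans (sym (+-suc (toℕ i) d)) i+d+1≡j
    i+1<m : suc (toℕ i) < m
    i+1<m = ≤-<-trans (≤-trans (m≤m+n (suc (toℕ i)) d) (≤-reflexive i+1+d≡j)) (toℕ<n j)

  path-walk : ∀ (i j : Fin m) → Walk (PathGraph m) i j ∣ toℕ i - toℕ j ∣
  path-walk i j with ≤-total (toℕ i) (toℕ j)
  ... | inj₁ i≤j = subst (Walk _ i j) (sym (m≤n⇒∣m-n∣≡n∸m i≤j)) (path-walk-up _ i j (m+[n∸m]≡n i≤j))
  ... | inj₂ j≤i = subst (Walk _ i j) (sym (m≤n⇒∣n-m∣≡n∸m j≤i))
                     (reverseʷ PathAdj-sym (path-walk-up _ j i (m+[n∸m]≡n j≤i)))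

  path-adjacent : ∀ {i j : Fin m} → PathAdj m i j → ∣ toℕ i - toℕ j ∣ ≡ 1
  path-adjacent {i} (inj₁ i+1≡j) =
    trans (cong (∣ toℕ i -_∣) (trans (sym i+1≡j) (+-comm 1 (toℕ i)))) (∣m-m+n∣≡n (toℕ i) 1)
  path-adjacent {i} {j} (inj₂ j+1≡i) =
    trans (∣-∣-comm (toℕ i) (toℕ j)) (path-adjacent {j} {i} (inj₁ j+1≡i))

module Grid {m n : ℕ} where

  manhattan : V (L m n) → V (L m n) → ℕ
  manhattan (x , y) (x' , y') = ∣ toℕ x - toℕ x' ∣ + ∣ toℕ y - toℕ y' ∣

  manhattan-triangle : ∀ u v w → manhattan u w ≤ manhattan u v + manhattan v w
  manhattan-triangle (x , y) (x' , y') (x'' , y'') = ≤-trans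
    (+-mono-≤ (∣-∣-triangle (toℕ x) (toℕ x') (toℕ x'')) (∣-∣-triangle (toℕ y) (toℕ y') (toℕ y'')))
    (≤-reflexive (interchange ∣ toℕ x - toℕ x' ∣ _ ∣ toℕ y - toℕ y' ∣ _))

  manhattan-adjacent : ∀ {u v} → Adj (L m n) u v → manhattan u v ≡ 1
  manhattan-adjacent {_ , y} (inj₁ (e , refl)) = cong₂ _+_ (path-adjacent e) (∣n-n∣≡0 (toℕ y))
  manhattan-adjacent {x , _} (inj₂ (refl , e)) = cong₂ _+_ (∣n-n∣≡0 (toℕ x)) (path-adjacent e)

  manhattan-walk : ∀ u v → Walk (L m n) u v (manhattan u v)
  manhattan-walk (x , y) (x' , y') = mapʷˡ y (path-walk x x') ++ʷ mapʷʳ x' (path-walk y y')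

  manhattan≤length : ∀ {u v k} → Walk (L m n) u v k → manhattan u v ≤ k
  manhattan≤length {x , y} here = ≤-reflexive (cong₂ _+_ (∣n-n∣≡0 (toℕ x)) (∣n-n∣≡0 (toℕ y)))
  manhattan≤length {u} {v} (step {v = w} e p) = ≤-trans (manhattan-triangle u w v)
    (+-mono-≤ (≤-reflexive (manhattan-adjacent e)) (manhattan≤length p))

  grid-distance : ∀ u v → Dist (L m n) u v (manhattan u v)
  grid-distance u v = manhattan-walk u v , λ _ → manhattan≤length

open Grid

double : ℕ → ℕ
double zero    = zero
double (suc t) = suc (suc (double t))

double≡+ : ∀ t → double t ≡ t + t
double≡+ zero    = refl
double≡+ (suc t) = cong suc (trans (cong suc (double≡+ t)) (sym (+-suc t t)))

double-mono-≤ : ∀ {s t} → s ≤ t → double s ≤ double t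
double-mono-≤ z≤n     = z≤n
double-mono-≤ (s≤s p) = s≤s (s≤s (double-mono-≤ p))

double-cancel-≤ : ∀ {s t} → double s ≤ double t → s ≤ t
double-cancel-≤ {zero}           _               = z≤n
double-cancel-≤ {suc s} {suc t} (s≤s (s≤s p)) = s≤s (double-cancel-≤ p)

odd≤double⇒< : ∀ {s t} → suc (double s) ≤ double t → s < t
odd≤double⇒< {zero}  {suc t} _               = s≤s z≤n
odd≤double⇒< {suc s} {suc t} (s≤s (s≤s p)) = s≤s (odd≤double⇒< p)

even-or-odd : ∀ r → (Σ ℕ λ t → r ≡ double t) ⊎ (Σ ℕ λ t → r ≡ suc (double t))
even-or-odd zero          = inj₁ (0 , refl)
even-or-odd (suc zero)    = inj₂ (0 , refl)
even-or-odd (suc (suc r)) with even-or-odd r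
... | inj₁ (t , refl) = inj₁ (suc t , refl)
... | inj₂ (t , refl) = inj₂ (suc t , refl)

⌊double/2⌋ : ∀ t → ⌊ double t /2⌋ ≡ t
⌊double/2⌋ zero    = refl
⌊double/2⌋ (suc t) = cong suc (⌊double/2⌋ t)

≤-double : ∀ t → t ≤ double t
≤-double t = subst (t ≤_) (sym (double≡+ t)) (m≤m+n t t)

2*≡double : ∀ t → 2 * t ≡ double t
2*≡double t = trans (cong (t +_) (+-identityʳ t)) (sym (double≡+ t))

⌊odd+odd/2⌋∸1 : ∀ a b → ⌊ suc (2 * a) + suc (2 * b) /2⌋ ∸ 1 ≡ a + b
⌊odd+odd/2⌋∸1 a b = cong (_∸ 1) (trans (cong ⌊_/2⌋ odd+odd) (⌊double/2⌋ (suc (a + b))))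
  where
  odd+odd : suc (2 * a) + suc (2 * b) ≡ double (suc (a + b))
  odd+odd = begin
    suc (2 * a) + suc (2 * b)   ≡⟨ cong suc (+-suc (2 * a) (2 * b)) ⟩
    suc (suc (2 * a + 2 * b))   ≡⟨ cong (suc ∘′ suc) (*-distribˡ-+ 2 a b) ⟨
    suc (suc (2 * (a + b)))     ≡⟨ cong (suc ∘′ suc) (2*≡double (a + b)) ⟩
    double (suc (a + b))        ∎
    where open ≡-Reasoning

record InverseOn (k : ℕ) (f g : ℕ → ℕ) : Set where
  field
    f-bound : ∀ {v} → v ≤ k → f v ≤ k
    g-bound : ∀ {v} → v ≤ k → g v ≤ k
    g∘f     : ∀ {v} → v ≤ k → g (f v) ≡ v
    f∘g     : ∀ {v} → v ≤ k → f (g v) ≡ v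

module _ {k : ℕ} where

  restrict : (h : ℕ → ℕ) → (∀ {v} → v ≤ k → h v ≤ k) → Fin (suc k) → Fin (suc k)
  restrict h h-bound i = fromℕ< (s≤s (h-bound (toℕ≤pred[n] i)))

  restrict-inverse : ∀ h h' (h-bound : ∀ {v} → v ≤ k → h v ≤ k)
                     (h'-bound : ∀ {v} → v ≤ k → h' v ≤ k) → (∀ {v} → v ≤ k → h (h' v) ≡ v) →
                     ∀ i → restrict h h-bound (restrict h' h'-bound i) ≡ i
  restrict-inverse h h' _ _ hh'≡id i = toℕ-injective (trans (toℕ-fromℕ< _)
    (trans (cong h (toℕ-fromℕ< _)) (hh'≡id (toℕ≤pred[n] i))))

  ℕ-permutation : ∀ {f g} → InverseOn k f g → Permutation′ (suc k)
  ℕ-permutation {f} {g} inv = permutation (restrict f f-bound) (restrict g g-bound)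
    (restrict-inverse f g f-bound g-bound f∘g) (restrict-inverse g f g-bound f-bound g∘f)
    where open InverseOn inv

  toℕ-ℕ-permutation : ∀ {f g} (inv : InverseOn k f g) i → toℕ (ℕ-permutation inv ⟨$⟩ʳ i) ≡ f (toℕ i)
  toℕ-ℕ-permutation inv i = toℕ-fromℕ< _

shear : ∀ {A B : Set} → (B → A ↔ A) → (A × B) ↔ (A × B)
shear π = mk↔ₛ′ (λ (x , y) → Inverse.to (π y) x , y) (λ (x , y) → Inverse.from (π y) x , y)
  (λ (x , y) → cong (_, y) (Inverse.strictlyInverseˡ (π y) x))
  (λ (x , y) → cong (_, y) (Inverse.strictlyInverseʳ (π y) x))

quotient-remainder-unique : ∀ {n} q q' {r r'} → r < n → r' < n →
                            q * n + r ≡ q' * n + r' → q ≡ q' × r ≡ r'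
quotient-remainder-unique zero    zero     _   _    e = refl , e
quotient-remainder-unique {n} zero (suc q') r<n _ e =
  contradiction (subst (n ≤_) (sym e) (≤-trans (m≤m+n n _) (m≤m+n _ _))) (<⇒≱ r<n)
quotient-remainder-unique {n} (suc q) zero _ r'<n e =
  contradiction (subst (n ≤_) e (≤-trans (m≤m+n n _) (m≤m+n _ _))) (<⇒≱ r'<n)
quotient-remainder-unique {n} (suc q) (suc q') {r} {r'} r<n r'<n e =
  let q≡q' , r≡r' = quotient-remainder-unique q q' r<n r'<n (+-cancelˡ-≡ n _ _ e′)
  in cong suc q≡q' , r≡r'
  where
  e′ : n + (q * n + r) ≡ n + (q' * n + r')
  e′ = trans (sym (+-assoc n (q * n) r)) (trans e (+-assoc n (q' * n) r'))

toℕ-remQuot : ∀ {m} n (i : Fin (m * n)) →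
               toℕ i ≡ toℕ (proj₁ (remQuot {m} n i)) * n + toℕ (proj₂ (remQuot {m} n i))
toℕ-remQuot {m} n i = begin
  toℕ i                                ≡⟨ cong toℕ (combine-remQuot {m} n i) ⟨
  toℕ (combine q r)                    ≡⟨ toℕ-combine q r ⟩
  n * toℕ q + toℕ r                    ≡⟨ cong (_+ toℕ r) (*-comm n (toℕ q)) ⟩
  toℕ q * n + toℕ r                    ∎
  where
  open ≡-Reasoning
  q = proj₁ (remQuot {m} n i)
  r = proj₂ (remQuot {m} n i)

successor-quotient-remainder : ∀ {n} q r q' r' → r < n → r' < n → q' * n + r' ≡ suc (q * n + r) →
                               (q' ≡ q × r' ≡ suc r) ⊎ (q' ≡ suc q × suc r ≡ n × r' ≡ 0)
successor-quotient-remainder {n} q r q' r' r<n r'<n e with suc r <? n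
... | yes r+1<n = inj₁ (quotient-remainder-unique q' q r'<n r+1<n (trans e (sym (+-suc (q * n) r))))
... | no  r+1≮n =
  let q'≡q+1 , r'≡0 = quotient-remainder-unique q' (suc q) r'<n (≤-trans (s≤s z≤n) r<n) e′
  in inj₂ (q'≡q+1 , r+1≡n , r'≡0)
  where
  r+1≡n : suc r ≡ n
  r+1≡n = ≤-antisym r<n (≮⇒≥ r+1≮n)
  e′ : q' * n + r' ≡ suc q * n + 0
  e′ = begin
    q' * n + r'     ≡⟨ e ⟩
    suc (q * n + r) ≡⟨ +-suc (q * n) r ⟨
    q * n + suc r   ≡⟨ cong (q * n +_) r+1≡n ⟩
    q * n + n       ≡⟨ +-comm (q * n) n ⟩
    suc q * n       ≡⟨ +-identityʳ _ ⟨
    suc q * n + 0   ∎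
    where open ≡-Reasoning

remQuot-suc : ∀ {m} n (i j : Fin (m * n)) → toℕ j ≡ suc (toℕ i) →
              let q , r = remQuot {m} n i ; q' , r' = remQuot {m} n j in
              (q' ≡ q × toℕ r' ≡ suc (toℕ r)) ⊎ (toℕ q' ≡ suc (toℕ q) × suc (toℕ r) ≡ n × toℕ r' ≡ 0)
remQuot-suc {m} n i j j≡i+1
  with successor-quotient-remainder (toℕ q) (toℕ r) (toℕ q') (toℕ r') (toℕ<n r) (toℕ<n r')
         (trans (sym (toℕ-remQuot {m} n j)) (trans j≡i+1 (cong suc (toℕ-remQuot {m} n i))))
  where
  q = proj₁ (remQuot {m} n i)
  r = proj₂ (remQuot {m} n i)
  q' = proj₁ (remQuot {m} n j)
  r' = proj₂ (remQuot {m} n j)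
... | inj₁ (q'≡q , r'≡r+1) = inj₁ (toℕ-injective q'≡q , r'≡r+1)
... | inj₂ last            = inj₂ last

-- Rotation by a of ℤ/(2a+1), on the representatives {0, …, 2a}.
module Rotation (a : ℕ) where

  rotate : ℕ → ℕ
  rotate v with v ≤? a
  ... | yes _ = v + a
  ... | no  _ = v ∸ suc a

  unrotate : ℕ → ℕ
  unrotate v with a ≤? v
  ... | yes _ = v ∸ a
  ... | no  _ = v + suc a

  rotate-low : ∀ {v} → v ≤ a → rotate v ≡ v + a
  rotate-low {v} v≤a with v ≤? a
  ... | yes _   = refl
  ... | no  v≰a = contradiction v≤a v≰a

  rotate-high : ∀ {v} → a < v → rotate v ≡ v ∸ suc a
  rotate-high {v} a<v with v ≤? a
  ... | yes v≤a = contradiction v≤a (<⇒≱ a<v)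
  ... | no  _   = refl

  unrotate-high : ∀ {v} → a ≤ v → unrotate v ≡ v ∸ a
  unrotate-high {v} a≤v with a ≤? v
  ... | yes _   = refl
  ... | no  a≰v = contradiction a≤v a≰v

  unrotate-low : ∀ {v} → v < a → unrotate v ≡ v + suc a
  unrotate-low {v} v<a with a ≤? v
  ... | yes a≤v = contradiction a≤v (<⇒≱ v<a)
  ... | no  _   = refl

  ≤double⇒∸≤ : ∀ {v} → v ≤ double a → v ∸ a ≤ a
  ≤double⇒∸≤ v≤2a = m≤n+o⇒m∸n≤o _ a (subst (_ ≤_) (double≡+ a) v≤2a)

  ∸suc< : ∀ {v} → v ≤ double a → a < v → v ∸ suc a < a
  ∸suc< {v} v≤2a a<v = subst (v ∸ suc a <_) (m+n∸m≡n (suc a) a)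
    (∸-monoˡ-< (s≤s (subst (v ≤_) (double≡+ a) v≤2a)) a<v)

  rotate-bound : ∀ {v} → v ≤ double a → rotate v ≤ double a
  rotate-bound {v} v≤2a with v ≤? a
  ... | yes v≤a = subst (v + a ≤_) (sym (double≡+ a)) (+-monoˡ-≤ a v≤a)
  ... | no  _   = ≤-trans (m∸n≤m v (suc a)) v≤2a

  unrotate-bound : ∀ {v} → v ≤ double a → unrotate v ≤ double a
  unrotate-bound {v} v≤2a with a ≤? v
  ... | yes _   = ≤-trans (m∸n≤m v a) v≤2a
  ... | no  a≰v = subst (v + suc a ≤_) (sym (double≡+ a))
                    (subst (_≤ a + a) (sym (+-suc v a)) (+-monoˡ-≤ a (≰⇒> a≰v)))

  unrotate-rotate : ∀ {v} → v ≤ double a → unrotate (rotate v) ≡ v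
  unrotate-rotate {v} v≤2a with v ≤? a
  ... | yes _   = trans (unrotate-high (m≤n+m a v)) (m+n∸n≡m v a)
  ... | no  v≰a = trans (unrotate-low (∸suc< v≤2a (≰⇒> v≰a)))
                        (m∸n+n≡m (≰⇒> v≰a))

  rotate-unrotate : ∀ {v} → v ≤ double a → rotate (unrotate v) ≡ v
  rotate-unrotate {v} v≤2a with a ≤? v
  ... | yes a≤v = trans (rotate-low (≤double⇒∸≤ v≤2a)) (m∸n+n≡m a≤v)
  ... | no  a≰v = trans (rotate-high (m≤n+m (suc a) v)) (m+n∸n≡m v (suc a))

  rotate-inverse : InverseOn (double a) rotate unrotate
  rotate-inverse = record
    { f-bound = rotate-bound ; g-bound = unrotate-bound
    ; g∘f = unrotate-rotate ; f∘g = rotate-unrotate }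

  a≤∣v-rotate-v∣ : ∀ v → a ≤ ∣ v - rotate v ∣
  a≤∣v-rotate-v∣ v with v ≤? a
  ... | yes _   = ≤-reflexive (sym (∣m-m+n∣≡n v a))
  ... | no  v≰a = subst (a ≤_)
                    (sym (trans (m≤n⇒∣n-m∣≡n∸m (m∸n≤m v (suc a))) (m∸[m∸n]≡n (≰⇒> v≰a))))
                    (n≤1+n a)

  rotate-crosses-upward : ∀ {v} → 0 < v → v ≤ a → a < rotate v
  rotate-crosses-upward {v} 0<v v≤a = subst (a <_) (sym (rotate-low v≤a)) (+-monoˡ-≤ a 0<v)

  rotate-crosses-downward : ∀ {v} → v ≤ double a → a < v → rotate v ≤ a
  rotate-crosses-downward {v} v≤2a a<v =
    subst (_≤ a) (sym (rotate-high a<v)) (<⇒≤ (∸suc< v≤2a a<v))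

  -- The orbit of a under rotation: a, 2a, a-1, 2a-1, …, 1, a+1, 0.
  orbit : ℕ → ℕ
  orbit zero    = a
  orbit (suc r) = rotate (orbit r)

  orbit-even : ∀ t s → t + s ≡ a → orbit (double t) ≡ s
  orbit-odd  : ∀ t s → 0 < s → t + s ≡ a → orbit (suc (double t)) ≡ s + a

  orbit-even zero    s e = sym e
  orbit-even (suc t) s e = begin
    rotate (orbit (suc (double t))) ≡⟨ cong rotate (orbit-odd t (suc s) z<s (trans (+-suc t s) e)) ⟩
    rotate (suc s + a)              ≡⟨ rotate-high (s≤s (m≤n+m a s)) ⟩
    s + a ∸ a                       ≡⟨ m+n∸n≡m s a ⟩
    s                               ∎
    where open ≡-Reasoning
  orbit-odd t s 0<s e = trans (cong rotate (orbit-even t s e)) (rotate-low (subst (s ≤_) e (m≤n+m s t)))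

  orbit⁻¹ : ℕ → ℕ
  orbit⁻¹ v with v ≤? a
  ... | yes _ = double (a ∸ v)
  ... | no  _ = suc (double (a ∸ (v ∸ a)))

  orbit⁻¹-low : ∀ {v} → v ≤ a → orbit⁻¹ v ≡ double (a ∸ v)
  orbit⁻¹-low {v} v≤a with v ≤? a
  ... | yes _   = refl
  ... | no  v≰a = contradiction v≤a v≰a

  orbit⁻¹-high : ∀ {v} → a < v → orbit⁻¹ v ≡ suc (double (a ∸ (v ∸ a)))
  orbit⁻¹-high {v} a<v with v ≤? a
  ... | yes v≤a = contradiction v≤a (<⇒≱ a<v)
  ... | no  _   = refl

  orbit-bound : ∀ r → orbit r ≤ double a
  orbit-bound zero    = ≤-double a
  orbit-bound (suc r) = rotate-bound (orbit-bound r)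

  orbit⁻¹-bound : ∀ {v} → v ≤ double a → orbit⁻¹ v ≤ double a
  orbit⁻¹-bound {v} v≤2a with v ≤? a
  ... | yes _   = double-mono-≤ (m∸n≤m a v)
  ... | no  v≰a = odd<double (∸-monoʳ-< (m<n⇒0<n∸m (≰⇒> v≰a)) (≤double⇒∸≤ v≤2a))
    where
    odd<double : ∀ {t} → t < a → suc (double t) ≤ double a
    odd<double t<a = ≤-trans (n≤1+n _) (double-mono-≤ t<a)

  orbit-orbit⁻¹ : ∀ {v} → v ≤ double a → orbit (orbit⁻¹ v) ≡ v
  orbit-orbit⁻¹ {v} v≤2a with v ≤? a
  ... | yes v≤a = orbit-even (a ∸ v) v (m∸n+n≡m v≤a)
  ... | no  v≰a = trans (orbit-odd _ (v ∸ a) (m<n⇒0<n∸m (≰⇒> v≰a)) (m∸n+n≡m (≤double⇒∸≤ v≤2a)))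
                        (m∸n+n≡m (<⇒≤ (≰⇒> v≰a)))

  orbit⁻¹-orbit : ∀ {r} → r ≤ double a → orbit⁻¹ (orbit r) ≡ r
  orbit⁻¹-orbit {r} r≤2a with even-or-odd r
  ... | inj₁ (t , refl) = begin
    orbit⁻¹ (orbit (double t)) ≡⟨ cong orbit⁻¹ (orbit-even t (a ∸ t) (m+[n∸m]≡n t≤a)) ⟩
    orbit⁻¹ (a ∸ t)            ≡⟨ orbit⁻¹-low (m∸n≤m a t) ⟩
    double (a ∸ (a ∸ t))       ≡⟨ cong double (m∸[m∸n]≡n t≤a) ⟩
    double t                   ∎
    where
    open ≡-Reasoning
    t≤a = double-cancel-≤ r≤2a
  ... | inj₂ (t , refl) = begin
    orbit⁻¹ (orbit (suc (double t)))   ≡⟨ cong orbit⁻¹ (orbit-odd t (a ∸ t) 0<a∸t (m+[n∸m]≡n (<⇒≤ t<a))) ⟩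
    orbit⁻¹ (a ∸ t + a)                ≡⟨ orbit⁻¹-high (+-monoˡ-≤ a 0<a∸t) ⟩
    suc (double (a ∸ (a ∸ t + a ∸ a))) ≡⟨ cong (λ z → suc (double (a ∸ z))) (m+n∸n≡m (a ∸ t) a) ⟩
    suc (double (a ∸ (a ∸ t)))         ≡⟨ cong (suc ∘′ double) (m∸[m∸n]≡n (<⇒≤ t<a)) ⟩
    suc (double t)                     ∎
    where
    open ≡-Reasoning
    t<a = odd≤double⇒< r≤2a
    0<a∸t = m<n⇒0<n∸m t<a

  orbit-last : orbit (double a) ≡ 0
  orbit-last = orbit-even a 0 (+-identityʳ a)

  orbit≡0⇒last : ∀ {r} → r ≤ double a → orbit r ≡ 0 → r ≡ double a
  orbit≡0⇒last {r} r≤2a orbit-r≡0 = begin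
    r                ≡⟨ orbit⁻¹-orbit r≤2a ⟨
    orbit⁻¹ (orbit r) ≡⟨ cong orbit⁻¹ orbit-r≡0 ⟩
    orbit⁻¹ 0         ≡⟨ orbit⁻¹-low z≤n ⟩
    double a          ∎
    where open ≡-Reasoning

  0<orbit : ∀ {r} → r < double a → 0 < orbit r
  0<orbit {r} r<2a = n≢0⇒n>0 (λ orbit-r≡0 → <⇒≢ r<2a (orbit≡0⇒last (<⇒≤ r<2a) orbit-r≡0))

  orbit-inverse : InverseOn (double a) orbit orbit⁻¹
  orbit-inverse = record
    { f-bound = λ {r} _ → orbit-bound r ; g-bound = orbit⁻¹-bound
    ; g∘f = orbit⁻¹-orbit ; f∘g = orbit-orbit⁻¹ }

middle : ∀ a → Fin (suc (double a))
middle a = fromℕ< (s≤s (≤-double a))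

toℕ-middle : ∀ a → toℕ (middle a) ≡ a
toℕ-middle a = toℕ-fromℕ< (s≤s (≤-double a))

∣middle-x∣≤ : ∀ a (x : Fin (suc (double a))) → ∣ toℕ (middle a) - toℕ x ∣ ≤ a
∣middle-x∣≤ a x rewrite toℕ-middle a with ≤-total a (toℕ x)
... | inj₁ a≤x = subst (_≤ a) (sym (m≤n⇒∣m-n∣≡n∸m a≤x))
                   (m≤n+o⇒m∸n≤o (toℕ x) a (subst (toℕ x ≤_) (double≡+ a) (toℕ≤pred[n] x)))
... | inj₂ x≤a = subst (_≤ a) (sym (m≤n⇒∣n-m∣≡n∸m x≤a)) (m∸n≤m a (toℕ x))

far-end : ∀ a (x : Fin (suc (double a))) → Σ (Fin (suc (double a))) λ o → a ≤ ∣ toℕ x - toℕ o ∣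
far-end a x with ≤-<-connex (toℕ x) a
... | inj₂ a<x = zero , subst (a ≤_) (sym (∣-∣-identityʳ (toℕ x))) (<⇒≤ a<x)
... | inj₁ x≤a = fromℕ (double a) , (begin
  a                                  ≡⟨ m+n∸n≡m a a ⟨
  a + a ∸ a                          ≡⟨ cong (_∸ a) (double≡+ a) ⟨
  double a ∸ a                       ≤⟨ ∸-monoʳ-≤ (double a) x≤a ⟩
  double a ∸ toℕ x                   ≡⟨ m≤n⇒∣m-n∣≡n∸m (toℕ≤pred[n] x) ⟨
  ∣ toℕ x - double a ∣               ≡⟨ cong (∣ toℕ x -_∣) (toℕ-fromℕ (double a)) ⟨
  ∣ toℕ x - toℕ (fromℕ (double a)) ∣ ∎)
  where open ≤-Reasoning

module OddGrid (a b : ℕ) where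

  M N : ℕ
  M = suc (double a)
  N = suc (double b)

  module A = Rotation a
  module B = Rotation b

  rotationA : Permutation′ M
  rotationA = ℕ-permutation A.rotate-inverse

  orbitA : Permutation′ M
  orbitA = ℕ-permutation A.orbit-inverse

  orbitB : Permutation′ N
  orbitB = ℕ-permutation B.orbit-inverse

  shift : ℕ → ℕ → ℕ
  shift y v with y ≤? b
  ... | yes _ = v
  ... | no  _ = A.rotate v

  column-shift : Fin N → Permutation′ M
  column-shift y with toℕ y ≤? b
  ... | yes _ = idₚ
  ... | no  _ = rotationA

  toℕ-column-shift : ∀ y x → toℕ (column-shift y ⟨$⟩ʳ x) ≡ shift (toℕ y) (toℕ x)
  toℕ-column-shift y x with toℕ y ≤? b
  ... | yes _ = refl
  ... | no  _ = toℕ-ℕ-permutation A.rotate-inverse x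

  shift-low : ∀ {y} v → y ≤ b → shift y v ≡ v
  shift-low {y} v y≤b with y ≤? b
  ... | yes _   = refl
  ... | no  y≰b = contradiction y≤b y≰b

  shift-high : ∀ {y} v → b < y → shift y v ≡ A.rotate v
  shift-high {y} v b<y with y ≤? b
  ... | yes y≤b = contradiction y≤b (<⇒≱ b<y)
  ... | no  _   = refl

  -- A nonzero y and its rotation lie on opposite sides of the middle row.
  a≤∣shift-shift∘rotate∣ : ∀ {y} v → y ≤ double b → 0 < y → a ≤ ∣ shift y v - shift (B.rotate y) v ∣
  a≤∣shift-shift∘rotate∣ {y} v y≤2b 0<y with ≤-<-connex y b
  ... | inj₁ y≤b = subst (a ≤_)
    (sym (cong₂ ∣_-_∣ (shift-low v y≤b) (shift-high v (B.rotate-crosses-upward 0<y y≤b))))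
    (A.a≤∣v-rotate-v∣ v)
  ... | inj₂ b<y = subst (a ≤_)
    (sym (trans (cong₂ ∣_-_∣ (shift-high v b<y) (shift-low v (B.rotate-crosses-downward y≤2b b<y)))
                (∣-∣-comm (A.rotate v) v)))
    (A.a≤∣v-rotate-v∣ v)

  place : (Fin M × Fin N) ↔ (Fin M × Fin N)
  place = shear column-shift ↔-∘ (orbitA ×-↔ orbitB)

  labelling : Fin (M * N) ⤖ V (L M N)
  labelling = ↔⇒⤖ (place ↔-∘ *↔×)

  open Inverse place using () renaming (to to place→)

  toℕ-place : ∀ q r → toℕ (proj₁ (place→ (q , r))) ≡ shift (B.orbit (toℕ r)) (A.orbit (toℕ q))
                    × toℕ (proj₂ (place→ (q , r))) ≡ B.orbit (toℕ r)
  toℕ-place q r =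
      trans (toℕ-column-shift (orbitB ⟨$⟩ʳ r) (orbitA ⟨$⟩ʳ q)) (cong₂ shift toℕ-y (toℕ-ℕ-permutation A.orbit-inverse q))
    , toℕ-y
    where toℕ-y = toℕ-ℕ-permutation B.orbit-inverse r

  manhattan-place : ∀ q r q' r' →
    manhattan (place→ (q , r)) (place→ (q' , r')) ≡
    ∣ shift (B.orbit (toℕ r)) (A.orbit (toℕ q)) - shift (B.orbit (toℕ r')) (A.orbit (toℕ q')) ∣
      + ∣ B.orbit (toℕ r) - B.orbit (toℕ r') ∣
  manhattan-place q r q' r' = cong₂ _+_ (cong₂ ∣_-_∣ (proj₁ (toℕ-place q r)) (proj₁ (toℕ-place q' r')))
                                        (cong₂ ∣_-_∣ (proj₂ (toℕ-place q r)) (proj₂ (toℕ-place q' r')))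

  step-within-block : ∀ v {r} → r < double b →
    a + b ≤ ∣ shift (B.orbit r) v - shift (B.orbit (suc r)) v ∣ + ∣ B.orbit r - B.orbit (suc r) ∣
  step-within-block v {r} r<2b =
    +-mono-≤ (a≤∣shift-shift∘rotate∣ v (B.orbit-bound r) (B.0<orbit r<2b)) (B.a≤∣v-rotate-v∣ (B.orbit r))

  step-across-blocks : ∀ q →
    a + b ≤ ∣ shift (B.orbit (double b)) (A.orbit q) - shift (B.orbit 0) (A.orbit (suc q)) ∣
              + ∣ B.orbit (double b) - B.orbit 0 ∣
  step-across-blocks q rewrite B.orbit-last =
    +-mono-≤ (subst (a ≤_) (sym (cong₂ ∣_-_∣ (shift-low v z≤n) (shift-low (A.rotate v) ≤-refl)))
                    (A.a≤∣v-rotate-v∣ v))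
             ≤-refl
    where v = A.orbit q

  consecutive-far : ∀ {q q' r r'} →
    (q' ≡ q × toℕ r' ≡ suc (toℕ r)) ⊎ (toℕ q' ≡ suc (toℕ q) × suc (toℕ r) ≡ N × toℕ r' ≡ 0) →
    a + b ≤ manhattan (place→ (q , r)) (place→ (q' , r'))
  consecutive-far {q} {_} {r} {r'} (inj₁ (refl , r'≡r+1))
    rewrite manhattan-place q r q r' | r'≡r+1 =
    step-within-block _ (subst (_≤ double b) r'≡r+1 (toℕ≤pred[n] r'))
  consecutive-far {q} {q'} {r} {r'} (inj₂ (q'≡q+1 , r+1≡N , r'≡0))
    rewrite manhattan-place q r q' r' | q'≡q+1 | r'≡0 | suc-injective r+1≡N =
    step-across-blocks (toℕ q)

  dispersed : IsDispersed (L M N) (M * N) labelling (a + b)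
  dispersed i j j≡i+1 = _ , grid-distance _ _ , consecutive-far (remQuot-suc N i j j≡i+1)

  center : V (L M N)
  center = middle a , middle b

  center-eccentricity : EccIs (L M N) center (a + b)
  center-eccentricity =
      ((zero , zero) , subst (Dist (L M N) center (zero , zero)) center-to-corner (grid-distance _ _))
    , λ u d D → ≤-trans (proj₂ D _ (manhattan-walk center u))
                        (+-mono-≤ (∣middle-x∣≤ a (proj₁ u)) (∣middle-x∣≤ b (proj₂ u)))
    where
    center-to-corner : manhattan center (zero , zero) ≡ a + b
    center-to-corner =
      cong₂ _+_ (trans (∣-∣-identityʳ _) (toℕ-middle a)) (trans (∣-∣-identityʳ _) (toℕ-middle b))

  a+b≤eccentricity : ∀ v e → EccIs (L M N) v e → a + b ≤ e
  a+b≤eccentricity (x , y) e (_ , ecc) = ≤-trans (+-mono-≤ (proj₂ (far-end a x)) (proj₂ (far-end b y)))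
                                                 (ecc _ _ (grid-distance _ _))

  radius-is : RadiusIs (L M N) (a + b)
  radius-is = (center , center-eccentricity) , a+b≤eccentricity

  DL-is : 1 ≤ a → DLIs (L M N) (M * N) (a + b)
  DL-is 1≤a = (labelling , dispersed) ,
              λ k → dispersion≤eccentricity L-sym 1<M*N center (proj₂ center-eccentricity)
    where
    1<M*N : 1 < M * N
    1<M*N = ≤-trans (s≤s (≤-trans 1≤a (≤-double a))) (m≤m*n M N)

theorem2p12 : ∀ (m n : ℕ) → Odd m → Odd n → 3 ≤ m → 3 ≤ n →
    DLIs (L m n) (m * n) (⌊ (n + m) /2⌋ ∸ 1) × RadiusIs (L m n) (⌊ (n + m) /2⌋ ∸ 1)
theorem2p12 _ _ (zero , refl) _ (s≤s ()) _
theorem2p12 _ _ (suc a , refl) (b , refl) _ _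
  = transport-sizes (cong suc (2*≡double (suc a))) (cong suc (2*≡double b))
                    (trans (⌊odd+odd/2⌋∸1 b (suc a)) (+-comm b (suc a)))
  where
  open OddGrid (suc a) b
  transport-sizes : ∀ {m n k} → m ≡ M → n ≡ N → k ≡ suc a + b →
                    DLIs (L m n) (m * n) k × RadiusIs (L m n) k
  transport-sizes refl refl refl = DL-is (s≤s z≤n) , radius-is
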